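{- Suppose that, in a universe $\mathcal U$, path-induced equivalences are closed under homotopies (if $\operatorname{isPIE}(f)$ and $f\sim g$ then $\operatorname{isPIE}(g)$) and that for every $X:\mathcal U$ the diagonal map $\delta_X$ is a path-induced equivalence. Then for all $A,B:\mathcal U$ and all $f,g:A\to B$, $f\sim g\to f=g$.
   Context: Martin-Löf type theory with a universe $\mathcal U$ (no extensionality axioms assumed). For $f,g:A\to B$, $f\sim g:=\prod_{x:A}f(x)=g(x)$. $\operatorname{idtofun}:(A=B)\to(A\to B)$ is defined by path induction with $\operatorname{idtofun}(\mathrm{refl}_A)=\mathrm{id}_A$. For $f:A\to B$, $\operatorname{isPIE}_{A,B}(f):=\sum_{p:A=B}f=\operatorname{idtofun}(p)$; $f$ is a path-induced equivalence if this type is inhabited. The diagonal of $X$ is $\Delta X:=\sum_{a,a':X}a=a'$ and the diagonal map is $\delta_X:X\to\Delta X$, $\delta_X(x)=(x,x,\mathrm{refl}_x)$. -}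

{-# OPTIONS --without-K #-}
module Defs where

open import Level using (Level; _⊔_)
open import Data.Product using (Σ; _,_)
open import Relation.Binary.PropositionalEquality using (_≡_; refl)

_∼_ : {a b : Level} {A : Set a} {B : Set b} → (A → B) → (A → B) → Set (a ⊔ b)
f ∼ g = ∀ x → f x ≡ g x

idtofun : {ℓ : Level} {A B : Set ℓ} → A ≡ B → A → B
idtofun refl x = x

isPIE : {ℓ : Level} {A B : Set ℓ} → (A → B) → Set (Level.suc ℓ)
isPIE {A = A} {B = B} f = Σ (A ≡ B) (λ p → f ≡ idtofun p)

Δ : {ℓ : Level} → Set ℓ → Set ℓ
Δ X = Σ X (λ a → Σ X (λ a' → a ≡ a'))

δ : {ℓ : Level} (X : Set ℓ) → X → Δ X
δ X x = x , x , refl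

PIEClosedUnderHomotopy : (ℓ : Level) → Set (Level.suc ℓ)
PIEClosedUnderHomotopy ℓ = {A B : Set ℓ} (f g : A → B) → isPIE f → f ∼ g → isPIE g

DiagonalsArePIE : (ℓ : Level) → Set (Level.suc ℓ)
DiagonalsArePIE ℓ = (X : Set ℓ) → isPIE (δ X)

{-# OPTIONS --without-K #-}
-- A path-induced equivalence is, after path induction, an identity function, so all
-- its retractions are equal. Both projections Δ B → B are retractions of δ B, hence
-- equal once δ B is path-induced. A homotopy H : f ∼ g packages f and g into the map
-- x ↦ (f x , g x , H x) into Δ B, and composing it with the two projections gives
-- f and g.
module Submission where

open import Defs
open import Level using (Level)
open import Data.Product using (_,_)
open import Function using (_∘_; id)
open import Relation.Binary.PropositionalEquality using (_≡_; refl; sym; trans; cong)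

private
  variable
    ℓ : Level

retractions-of-PIE-unique : {X Y : Set ℓ} {e : X → Y} → isPIE e →
  (r s : Y → X) → r ∘ e ≡ id → s ∘ e ≡ id → r ≡ s
retractions-of-PIE-unique (refl , refl) r s r∘e≡id s∘e≡id = trans r∘e≡id (sym s∘e≡id)

Δ-proj₁ : {X : Set ℓ} → Δ X → X
Δ-proj₁ (a , _ , _) = a

Δ-proj₂ : {X : Set ℓ} → Δ X → X
Δ-proj₂ (_ , a' , _) = a'

Δ-proj₁≡Δ-proj₂ : {X : Set ℓ} → isPIE (δ X) → Δ-proj₁ ≡ Δ-proj₂
Δ-proj₁≡Δ-proj₂ δ-isPIE = retractions-of-PIE-unique δ-isPIE Δ-proj₁ Δ-proj₂ refl refl

theorem2p39 : (ℓ : Level) → PIEClosedUnderHomotopy ℓ → DiagonalsArePIE ℓ →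
    {A B : Set ℓ} (f g : A → B) → f ∼ g → f ≡ g
theorem2p39 ℓ _ diagonalsArePIE {B = B} f g f∼g =
  cong (_∘ λ x → f x , g x , f∼g x) (Δ-proj₁≡Δ-proj₂ (diagonalsArePIE B))
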